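{- Consider the Fitch-style calculus for Intuitionistic S4 interpreted in a cartesian closed category $\mathcal{C}$ with an adjunction $\Diamond\dashv\Box$ in which $\Box$ is an idempotent comonad. (1) If $D$ is a derivation of $\Gamma,x:A,\Gamma'\vdash t:B$ and $x$ is not free in $t$, and $D'$ is the derivation of $\Gamma,\Gamma'\vdash t:B$ obtained from $D$ by strengthening away $x:A$, then $[\![D]\!]=[\![D']\!]\circ[\![\Gamma']\!](\mathrm{pr})$, where $\mathrm{pr}:[\![\Gamma]\!]\times[\![A]\!]\to[\![\Gamma]\!]$ is the projection. (2) If $D$ is a derivation of $\Gamma,\bullet,\Gamma'\vdash t:B$ and $D'$ is the derivation of $\Gamma,\Gamma'\vdash t:B$ obtained from $D$ by strengthening away this lock, then $[\![D']\!]=[\![D]\!]\circ[\![\Gamma']\!](\eta_{[\![\Gamma]\!]})$.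
   Context: Calculus: types $A,B ::= p \mid 1 \mid A\times B \mid A\to B \mid \Box A$; contexts $\Gamma ::= \cdot \mid \Gamma,x:A \mid \Gamma,\bullet$ ($\bullet$ a structural symbol called a lock). Rules: (var) $\Gamma,x:A,\Gamma'\vdash x:A$ provided $\Gamma'$ contains no lock; usual rules for $1,\times,\to$; (shut) from $\Gamma,\bullet\vdash t:A$ infer $\Gamma\vdash\mathrm{shut}\,t:\Box A$; (open) from $\Gamma\vdash t:\Box A$ infer $\Gamma,\Gamma'\vdash\mathrm{open}\,t:A$ for any context $\Gamma'$. Strengthening: if $D$ derives $\Gamma,\Delta,\Gamma'\vdash t:B$ and no variable of $\Delta$ is free in $t$, the strengthened derivation of $\Gamma,\Gamma'\vdash t:B$ is obtained by deleting these occurrences of the entries of $\Delta$ from every sequent of $D$ in which they occur. Semantics: $(\Diamond,\eta,\mu)$ is the monad induced by the comonad $\Box$ via the adjunction (unit $\eta^m$, counit $\varepsilon^m$); idempotence means each $\mu_X$ is an isomorphism with inverse $\eta_{\Diamond X}=\Diamond\eta_X$. Types are interpreted via the cartesian closed structure and $\Box$ (atoms arbitrary). A context $\Gamma$ denotes an endofunctor: $[\![\cdot]\!]=\mathrm{Id}$, $[\![\Gamma,x:A]\!](X)=[\![\Gamma]\!](X)\times[\![A]\!]$, $[\![\Gamma,\bullet]\!](X)=\Diamond[\![\Gamma]\!](X)$, and the object $[\![\Gamma]\!]=[\![\Gamma]\!](1)$, so $[\![\Gamma,\Gamma']\!]=[\![\Gamma']\!]([\![\Gamma]\!])$. Lock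 replacement $l_\Gamma:[\![\Gamma]\!]\Rightarrow\Diamond$: $l_\cdot=\eta$, $(l_{\Gamma,x:A})_X=(l_\Gamma)_X\circ\mathrm{pr}$, $(l_{\Gamma,\bullet})_X=\mu_X\circ\Diamond(l_\Gamma)_X$. A derivation $D$ of $\Gamma\vdash t:A$ denotes $[\![D]\!]:[\![\Gamma]\!]\to[\![A]\!]$ by induction: variables by projections, $1,\times,\to$ by the cartesian closed structure, $[\![\mathrm{shut}\,t]\!]=\Box[\![t]\!]\circ\eta^m_{[\![\Gamma]\!]}$ (the adjoint transpose), and $[\![\Gamma,\Gamma'\vdash\mathrm{open}\,t]\!]=\varepsilon^m_{[\![A]\!]}\circ\Diamond[\![t]\!]\circ(l_{\Gamma'})_{[\![\Gamma]\!]}$. -}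

module Defs where

open import Level using (Level; _⊔_) renaming (suc to lsuc)
open import Data.Nat using (ℕ; _≟_)
open import Data.Empty using (⊥; ⊥-elim)
open import Relation.Nullary using (¬_; yes; no)
open import Relation.Binary using (Rel; IsEquivalence)
open import Relation.Binary.PropositionalEquality using (_≡_; refl; sym; cong; subst)

record Category (o ℓ e : Level) : Set (lsuc (o ⊔ ℓ ⊔ e)) where
  infixr 9 _∘_
  infix  4 _≈_
  infixr 5 _⇒_
  field
    Obj  : Set o
    _⇒_  : Obj → Obj → Set ℓ
    _≈_  : ∀ {A B} → Rel (A ⇒ B) e
    id   : ∀ {A} → A ⇒ A
    _∘_  : ∀ {A B C} → B ⇒ C → A ⇒ B → A ⇒ C
    equiv     : ∀ {A B} → IsEquivalence (_≈_ {A} {B})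
    assoc     : ∀ {A B C D} {f : A ⇒ B} {g : B ⇒ C} {h : C ⇒ D} →
                (h ∘ g) ∘ f ≈ h ∘ (g ∘ f)
    identityˡ : ∀ {A B} {f : A ⇒ B} → id ∘ f ≈ f
    identityʳ : ∀ {A B} {f : A ⇒ B} → f ∘ id ≈ f
    ∘-resp-≈  : ∀ {A B C} {f h : B ⇒ C} {g i : A ⇒ B} →
                f ≈ h → g ≈ i → f ∘ g ≈ h ∘ i

record Functor {o ℓ e} (C : Category o ℓ e) : Set (o ⊔ ℓ ⊔ e) where
  open Category C
  field
    F₀ : Obj → Obj
    F₁ : ∀ {A B} → A ⇒ B → F₀ A ⇒ F₀ B
    identity     : ∀ {A} → F₁ (id {A}) ≈ id
    homomorphism : ∀ {A B C} {f : A ⇒ B} {g : B ⇒ C} → F₁ (g ∘ f) ≈ F₁ g ∘ F₁ f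
    F-resp-≈     : ∀ {A B} {f g : A ⇒ B} → f ≈ g → F₁ f ≈ F₁ g

record CartesianClosed {o ℓ e} (C : Category o ℓ e) : Set (o ⊔ ℓ ⊔ e) where
  open Category C
  infixr 7 _×_
  field
    ⊤        : Obj
    !        : ∀ {A} → A ⇒ ⊤
    !-unique : ∀ {A} (f : A ⇒ ⊤) → ! ≈ f
    _×_      : Obj → Obj → Obj
    π₁       : ∀ {A B} → A × B ⇒ A
    π₂       : ∀ {A B} → A × B ⇒ B
    ⟨_,_⟩    : ∀ {X A B} → X ⇒ A → X ⇒ B → X ⇒ A × B
    project₁ : ∀ {X A B} {f : X ⇒ A} {g : X ⇒ B} → π₁ ∘ ⟨ f , g ⟩ ≈ f
    project₂ : ∀ {X A B} {f : X ⇒ A} {g : X ⇒ B} → π₂ ∘ ⟨ f , g ⟩ ≈ g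
    ⟨⟩-unique : ∀ {X A B} {f : X ⇒ A} {g : X ⇒ B} {h : X ⇒ A × B} →
                π₁ ∘ h ≈ f → π₂ ∘ h ≈ g → ⟨ f , g ⟩ ≈ h
    [_,_]    : Obj → Obj → Obj
    eval     : ∀ {A B} → [ A , B ] × A ⇒ B
    curry    : ∀ {X A B} → X × A ⇒ B → X ⇒ [ A , B ]
    β        : ∀ {X A B} {f : X × A ⇒ B} →
               eval ∘ ⟨ curry f ∘ π₁ , π₂ ⟩ ≈ f
    curry-unique : ∀ {X A B} {f : X × A ⇒ B} {h : X ⇒ [ A , B ]} →
                   eval ∘ ⟨ h ∘ π₁ , π₂ ⟩ ≈ f → h ≈ curry f

  _⁂_ : ∀ {A B C D} → A ⇒ B → C ⇒ D → A × C ⇒ B × D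
  f ⁂ g = ⟨ f ∘ π₁ , g ∘ π₂ ⟩

-- A model: CCC with an adjunction ◇ ⊣ □ where □ is a comonad;
-- ◇ carries the monad (η, μ) induced from the comonad via the adjunction,
-- and □ is idempotent (μ is an iso with inverse η_◇ = ◇η).

record Model (o ℓ e : Level) : Set (lsuc (o ⊔ ℓ ⊔ e)) where
  field
    C   : Category o ℓ e
    ccc : CartesianClosed C
    Dia : Functor C
    Box : Functor C
  open Category C public
  open CartesianClosed ccc public
  private
    module D = Functor Dia
    module B = Functor Box
  ◇ : Obj → Obj
  ◇ = D.F₀
  ◇₁ : ∀ {X Y} → X ⇒ Y → ◇ X ⇒ ◇ Y
  ◇₁ = D.F₁
  □ : Obj → Obj
  □ = B.F₀
  □₁ : ∀ {X Y} → X ⇒ Y → □ X ⇒ □ Y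
  □₁ = B.F₁
  field
    ηᵐ : ∀ X → X ⇒ □ (◇ X)
    εᵐ : ∀ X → ◇ (□ X) ⇒ X
    ηᵐ-natural : ∀ {X Y} (f : X ⇒ Y) → ηᵐ Y ∘ f ≈ □₁ (◇₁ f) ∘ ηᵐ X
    εᵐ-natural : ∀ {X Y} (f : X ⇒ Y) → εᵐ Y ∘ ◇₁ (□₁ f) ≈ f ∘ εᵐ X
    zig : ∀ {X} → εᵐ (◇ X) ∘ ◇₁ (ηᵐ X) ≈ id
    zag : ∀ {X} → □₁ (εᵐ X) ∘ ηᵐ (□ X) ≈ id
    ε : ∀ X → □ X ⇒ X
    δ : ∀ X → □ X ⇒ □ (□ X)
    ε-natural : ∀ {X Y} (f : X ⇒ Y) → ε Y ∘ □₁ f ≈ f ∘ ε X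
    δ-natural : ∀ {X Y} (f : X ⇒ Y) → δ Y ∘ □₁ f ≈ □₁ (□₁ f) ∘ δ X
    comonad-identityˡ : ∀ {X} → ε (□ X) ∘ δ X ≈ id
    comonad-identityʳ : ∀ {X} → □₁ (ε X) ∘ δ X ≈ id
    comonad-assoc     : ∀ {X} → δ (□ X) ∘ δ X ≈ □₁ (δ X) ∘ δ X

  -- the monad (◇, η, μ) induced by the comonad □ via the adjunction (mates)
  η : ∀ X → X ⇒ ◇ X
  η X = ε (◇ X) ∘ ηᵐ X

  μ : ∀ X → ◇ (◇ X) ⇒ ◇ X
  μ X = εᵐ (◇ X) ∘ (◇₁ (εᵐ (□ (◇ X))) ∘ (◇₁ (◇₁ (δ (◇ X))) ∘ ◇₁ (◇₁ (ηᵐ X))))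

  field
    idem-μη : ∀ {X} → μ X ∘ η (◇ X) ≈ id
    idem-ημ : ∀ {X} → η (◇ X) ∘ μ X ≈ id
    idem-◇η : ∀ {X} → ◇₁ (η X) ≈ η (◇ X)

Name : Set
Name = ℕ

infixr 7 _⊗_
infixr 6 _⇨_
data Ty : Set where
  base : ℕ → Ty
  𝟙    : Ty
  _⊗_  : Ty → Ty → Ty
  _⇨_  : Ty → Ty → Ty
  □ᵗ   : Ty → Ty

infixl 5 _,_∶_
data Ctx : Set where
  ·     : Ctx
  _,_∶_ : Ctx → Name → Ty → Ctx
  _,•   : Ctx → Ctx

infixl 4 _⧺_
_⧺_ : Ctx → Ctx → Ctx
Γ ⧺ ·          = Γ
Γ ⧺ (Δ , x ∶ A) = (Γ ⧺ Δ) , x ∶ A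
Γ ⧺ (Δ ,•)     = (Γ ⧺ Δ) ,•

data Tm : Set where
  var   : Name → Tm
  tt    : Tm
  pair  : Tm → Tm → Tm
  fst   : Tm → Tm
  snd   : Tm → Tm
  lam   : Name → Tm → Tm
  app   : Tm → Tm → Tm
  shut  : Tm → Tm
  open′ : Tm → Tm

infix 4 _∈FV_
data _∈FV_ (x : Name) : Tm → Set where
  fv-var   : x ∈FV var x
  fv-pairₗ : ∀ {t u} → x ∈FV t → x ∈FV pair t u
  fv-pairᵣ : ∀ {t u} → x ∈FV u → x ∈FV pair t u
  fv-fst   : ∀ {t} → x ∈FV t → x ∈FV fst t
  fv-snd   : ∀ {t} → x ∈FV t → x ∈FV snd t
  fv-lam   : ∀ {y t} → ¬ (x ≡ y) → x ∈FV t → x ∈FV lam y t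
  fv-appₗ  : ∀ {t u} → x ∈FV t → x ∈FV app t u
  fv-appᵣ  : ∀ {t u} → x ∈FV u → x ∈FV app t u
  fv-shut  : ∀ {t} → x ∈FV t → x ∈FV shut t
  fv-open  : ∀ {t} → x ∈FV t → x ∈FV open′ t

infix 4 _∈dom_
data _∈dom_ (x : Name) : Ctx → Set where
  here  : ∀ {Γ A} → x ∈dom (Γ , x ∶ A)
  there : ∀ {Γ y A} → x ∈dom Γ → x ∈dom (Γ , y ∶ A)
  skip  : ∀ {Γ} → x ∈dom Γ → x ∈dom (Γ ,•)

-- Γ ∋ x ∶ A : Γ = Γ₁ , x ∶ A , Γ₂ with Γ₂ lock-free
infix 4 _∋_∶_
data _∋_∶_ : Ctx → Name → Ty → Set where
  here  : ∀ {Γ x A} → (Γ , x ∶ A) ∋ x ∶ A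
  there : ∀ {Γ x A y B} → Γ ∋ x ∶ A → (Γ , y ∶ B) ∋ x ∶ A

infix 3 _⊢_∶_
data _⊢_∶_ : Ctx → Tm → Ty → Set where
  var  : ∀ {Γ x A} → Γ ∋ x ∶ A → Γ ⊢ var x ∶ A
  tt   : ∀ {Γ} → Γ ⊢ tt ∶ 𝟙
  pair : ∀ {Γ t u A B} → Γ ⊢ t ∶ A → Γ ⊢ u ∶ B → Γ ⊢ pair t u ∶ A ⊗ B
  fst  : ∀ {Γ t A B} → Γ ⊢ t ∶ A ⊗ B → Γ ⊢ fst t ∶ A
  snd  : ∀ {Γ t A B} → Γ ⊢ t ∶ A ⊗ B → Γ ⊢ snd t ∶ B
  lam  : ∀ {Γ x t A B} → ¬ (x ∈dom Γ) → Γ , x ∶ A ⊢ t ∶ B → Γ ⊢ lam x t ∶ A ⇨ B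
  app  : ∀ {Γ t u A B} → Γ ⊢ t ∶ A ⇨ B → Γ ⊢ u ∶ A → Γ ⊢ app t u ∶ B
  shut : ∀ {Γ t A} → Γ ,• ⊢ t ∶ A → Γ ⊢ shut t ∶ □ᵗ A
  open′ : ∀ {Γ t A} (Γ′ : Ctx) → Γ ⊢ t ∶ □ᵗ A → Γ ⧺ Γ′ ⊢ open′ t ∶ A

data Entry : Set where
  evar  : Name → Ty → Entry
  elock : Entry

data Del : Entry → Ctx → Ctx → Set where
  del-var   : ∀ {Γ x A} → Del (evar x A) (Γ , x ∶ A) Γ
  del-lock  : ∀ {Γ} → Del elock (Γ ,•) Γ
  keep-var  : ∀ {e Δ Δ⁻ y B} → Del e Δ Δ⁻ → Del e (Δ , y ∶ B) (Δ⁻ , y ∶ B)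
  keep-lock : ∀ {e Δ Δ⁻} → Del e Δ Δ⁻ → Del e (Δ ,•) (Δ⁻ ,•)

delVarAt : ∀ Γ x A Γ′ → Del (evar x A) ((Γ , x ∶ A) ⧺ Γ′) (Γ ⧺ Γ′)
delVarAt Γ x A ·          = del-var
delVarAt Γ x A (Γ′ , y ∶ B) = keep-var (delVarAt Γ x A Γ′)
delVarAt Γ x A (Γ′ ,•)    = keep-lock (delVarAt Γ x A Γ′)

delLockAt : ∀ Γ Γ′ → Del elock ((Γ ,•) ⧺ Γ′) (Γ ⧺ Γ′)
delLockAt Γ ·          = del-lock
delLockAt Γ (Γ′ , y ∶ B) = keep-var (delLockAt Γ Γ′)
delLockAt Γ (Γ′ ,•)    = keep-lock (delLockAt Γ Γ′)

NF : Entry → Tm → Set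
NF e t = ∀ {x A} → e ≡ evar x A → ¬ (x ∈FV t)

data SplitDel (e : Entry) (Γ Γ′ : Ctx) : Ctx → Set where
  left  : ∀ {Γ⁻} → Del e Γ Γ⁻ → SplitDel e Γ Γ′ (Γ⁻ ⧺ Γ′)
  right : ∀ {Γ′⁻} → Del e Γ′ Γ′⁻ → SplitDel e Γ Γ′ (Γ ⧺ Γ′⁻)

splitDel : ∀ {e Δ⁻} Γ Γ′ → Del e (Γ ⧺ Γ′) Δ⁻ → SplitDel e Γ Γ′ Δ⁻
splitDel Γ · d = left d
splitDel Γ (Γ′ , y ∶ B) del-var = right del-var
splitDel Γ (Γ′ , y ∶ B) (keep-var d) with splitDel Γ Γ′ d
... | left d′  = left d′
... | right d′ = right (keep-var d′)
splitDel Γ (Γ′ ,•) del-lock = right del-lock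
splitDel Γ (Γ′ ,•) (keep-lock d) with splitDel Γ Γ′ d
... | left d′  = left d′
... | right d′ = right (keep-lock d′)

del-dom : ∀ {e Δ Δ⁻ y} → Del e Δ Δ⁻ → y ∈dom Δ⁻ → y ∈dom Δ
del-dom del-var p = there p
del-dom del-lock p = skip p
del-dom (keep-var d) here = here
del-dom (keep-var d) (there p) = there (del-dom d p)
del-dom (keep-lock d) (skip p) = skip (del-dom d p)

del-entry : ∀ {x A Δ Δ⁻} → Del (evar x A) Δ Δ⁻ → x ∈dom Δ
del-entry del-var = here
del-entry (keep-var d) = there (del-entry d)
del-entry (keep-lock d) = skip (del-entry d)

strengthen-∋ : ∀ {e Δ Δ⁻ x A} → Del e Δ Δ⁻ → Δ ∋ x ∶ A → NF e (var x) → Δ⁻ ∋ x ∶ A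
strengthen-∋ del-var here nf = ⊥-elim (nf refl fv-var)
strengthen-∋ del-var (there m) nf = m
strengthen-∋ (keep-var d) here nf = here
strengthen-∋ (keep-var d) (there m) nf = there (strengthen-∋ d m nf)

nf-lam : ∀ {e Δ Δ⁻ y t} → Del e Δ Δ⁻ → ¬ (y ∈dom Δ) → NF e (lam y t) → NF e t
nf-lam {y = y} d fr nf {x} refl fx with x ≟ y
... | yes refl = fr (del-entry d)
... | no x≢y = nf refl (fv-lam x≢y fx)

strengthen : ∀ {e Δ Δ⁻ t A} → Del e Δ Δ⁻ → Δ ⊢ t ∶ A → NF e t → Δ⁻ ⊢ t ∶ A
strengthen d (var m) nf = var (strengthen-∋ d m nf)
strengthen d tt nf = tt
strengthen d (pair D₁ D₂) nf =
  pair (strengthen d D₁ (λ p f → nf p (fv-pairₗ f)))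
       (strengthen d D₂ (λ p f → nf p (fv-pairᵣ f)))
strengthen d (fst D) nf = fst (strengthen d D (λ p f → nf p (fv-fst f)))
strengthen d (snd D) nf = snd (strengthen d D (λ p f → nf p (fv-snd f)))
strengthen d (lam fr D) nf =
  lam (λ p → fr (del-dom d p)) (strengthen (keep-var d) D (nf-lam d fr nf))
strengthen d (app D₁ D₂) nf =
  app (strengthen d D₁ (λ p f → nf p (fv-appₗ f)))
      (strengthen d D₂ (λ p f → nf p (fv-appᵣ f)))
strengthen d (shut D) nf = shut (strengthen (keep-lock d) D (λ p f → nf p (fv-shut f)))
strengthen d (open′ {Γ = Γ} Γ′ D) nf with splitDel Γ Γ′ d
... | left d′  = open′ Γ′ (strengthen d′ D (λ p f → nf p (fv-open f)))
... | right {Γ′⁻} d′ = open′ Γ′⁻ D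

strengthenVar : ∀ Γ x A Γ′ {t B} → (Γ , x ∶ A) ⧺ Γ′ ⊢ t ∶ B → ¬ (x ∈FV t) →
                Γ ⧺ Γ′ ⊢ t ∶ B
strengthenVar Γ x A Γ′ D nf = strengthen (delVarAt Γ x A Γ′) D (λ { refl → nf })

strengthenLock : ∀ Γ Γ′ {t B} → (Γ ,•) ⧺ Γ′ ⊢ t ∶ B → Γ ⧺ Γ′ ⊢ t ∶ B
strengthenLock Γ Γ′ D = strengthen (delLockAt Γ Γ′) D (λ ())

module Semantics {o ℓ e} (M : Model o ℓ e) (atom : ℕ → Model.Obj M) where
  open Model M

  ⟦_⟧ty : Ty → Obj
  ⟦ base p ⟧ty = atom p
  ⟦ 𝟙 ⟧ty      = ⊤
  ⟦ A ⊗ B ⟧ty  = ⟦ A ⟧ty × ⟦ B ⟧ty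
  ⟦ A ⇨ B ⟧ty  = [ ⟦ A ⟧ty , ⟦ B ⟧ty ]
  ⟦ □ᵗ A ⟧ty   = □ ⟦ A ⟧ty

  ⟦_⟧F : Ctx → Obj → Obj
  ⟦ · ⟧F X        = X
  ⟦ Γ , x ∶ A ⟧F X = ⟦ Γ ⟧F X × ⟦ A ⟧ty
  ⟦ Γ ,• ⟧F X     = ◇ (⟦ Γ ⟧F X)

  ⟦_⟧F₁ : (Γ : Ctx) → ∀ {X Y} → X ⇒ Y → ⟦ Γ ⟧F X ⇒ ⟦ Γ ⟧F Y
  ⟦ · ⟧F₁ f        = f
  ⟦ Γ , x ∶ A ⟧F₁ f = ⟦ Γ ⟧F₁ f ⁂ id
  ⟦ Γ ,• ⟧F₁ f     = ◇₁ (⟦ Γ ⟧F₁ f)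

  ⟦_⟧ctx : Ctx → Obj
  ⟦ Γ ⟧ctx = ⟦ Γ ⟧F ⊤

  ⧺-sem : ∀ Γ Γ′ → ⟦ Γ ⧺ Γ′ ⟧ctx ≡ ⟦ Γ′ ⟧F ⟦ Γ ⟧ctx
  ⧺-sem Γ ·          = refl
  ⧺-sem Γ (Γ′ , x ∶ A) = cong (_× ⟦ A ⟧ty) (⧺-sem Γ Γ′)
  ⧺-sem Γ (Γ′ ,•)    = cong ◇ (⧺-sem Γ Γ′)

  ≡⇒ : ∀ {X Y} → X ≡ Y → X ⇒ Y
  ≡⇒ refl = id

  l : (Γ : Ctx) → ∀ X → ⟦ Γ ⟧F X ⇒ ◇ X
  l · X          = η X
  l (Γ , x ∶ A) X = l Γ X ∘ π₁
  l (Γ ,•) X     = μ X ∘ ◇₁ (l Γ X)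

  ⟦_⟧∋ : ∀ {Γ x A} → Γ ∋ x ∶ A → ⟦ Γ ⟧ctx ⇒ ⟦ A ⟧ty
  ⟦ here ⟧∋    = π₂
  ⟦ there m ⟧∋ = ⟦ m ⟧∋ ∘ π₁

  ⟦_⟧ : ∀ {Γ t A} → Γ ⊢ t ∶ A → ⟦ Γ ⟧ctx ⇒ ⟦ A ⟧ty
  ⟦ var m ⟧      = ⟦ m ⟧∋
  ⟦ tt ⟧         = !
  ⟦ pair D₁ D₂ ⟧ = ⟨ ⟦ D₁ ⟧ , ⟦ D₂ ⟧ ⟩
  ⟦ fst D ⟧      = π₁ ∘ ⟦ D ⟧
  ⟦ snd D ⟧      = π₂ ∘ ⟦ D ⟧
  ⟦ lam _ D ⟧    = curry ⟦ D ⟧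
  ⟦ app D₁ D₂ ⟧  = eval ∘ ⟨ ⟦ D₁ ⟧ , ⟦ D₂ ⟧ ⟩
  ⟦ shut {Γ} D ⟧ = □₁ ⟦ D ⟧ ∘ ηᵐ ⟦ Γ ⟧ctx
  ⟦ open′ {Γ} {A = A} Γ′ D ⟧ =
    εᵐ ⟦ A ⟧ty ∘ (◇₁ ⟦ D ⟧ ∘ (l Γ′ ⟦ Γ ⟧ctx ∘ ≡⇒ (⧺-sem Γ Γ′)))

-- Strengthening is an instance of a general fact about deleting one context entry:
-- the interpretation of each typing rule is natural in a morphism between context
-- interpretations, and deleting a variable is interpreted by π₁ (deleting a lock by η)
-- under the functor of the entries that follow it.  The only case that is not
-- purely structural is open′, which discards the context Γ′ through the lock
-- replacement: a deleted entry before Γ′ passes under ◇ by naturality of η and μ,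
-- and one inside Γ′ is absorbed by the lock replacement, for a lock because
-- μ ∘ η_◇ = id by idempotence.
module Submission where

open import Defs
open import Data.Nat using (ℕ)
open import Data.Product using () renaming (_×_ to _∧_; _,_ to _&_)
open import Data.Empty using (⊥-elim)
open import Relation.Nullary using (¬_)
open import Relation.Binary using (Setoid; IsEquivalence)
open import Relation.Binary.PropositionalEquality using (_≡_; refl; sym; cong)
import Relation.Binary.Reasoning.Setoid as SetoidReasoning

module Soundness {o ℓ e} (M : Model o ℓ e) (atom : ℕ → Model.Obj M) where
  open Model M
  open Semantics M atom
  module ≈ {A B} = IsEquivalence (equiv {A} {B})
  private
    module ◇F = Functor Dia
    module □F = Functor Box

    hom-setoid : Obj → Obj → Setoid ℓ e
    hom-setoid A B = record { isEquivalence = equiv {A} {B} }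

    module HomReasoning {A B} = SetoidReasoning (hom-setoid A B)
    open HomReasoning

  ∘-resp-≈ˡ : ∀ {A B C} {f h : B ⇒ C} {g : A ⇒ B} → f ≈ h → f ∘ g ≈ h ∘ g
  ∘-resp-≈ˡ p = ∘-resp-≈ p ≈.refl

  ∘-resp-≈ʳ : ∀ {A B C} {f : B ⇒ C} {g i : A ⇒ B} → g ≈ i → f ∘ g ≈ f ∘ i
  ∘-resp-≈ʳ p = ∘-resp-≈ ≈.refl p

  ⟨⟩-resp-≈ : ∀ {X A B} {f f′ : X ⇒ A} {g g′ : X ⇒ B} →
              f ≈ f′ → g ≈ g′ → ⟨ f , g ⟩ ≈ ⟨ f′ , g′ ⟩
  ⟨⟩-resp-≈ p q = ≈.sym (⟨⟩-unique (≈.trans project₁ p) (≈.trans project₂ q))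

  ⟨⟩∘ : ∀ {Y X A B} {f : X ⇒ A} {g : X ⇒ B} {h : Y ⇒ X} →
        ⟨ f , g ⟩ ∘ h ≈ ⟨ f ∘ h , g ∘ h ⟩
  ⟨⟩∘ = ≈.sym (⟨⟩-unique (≈.trans (≈.sym assoc) (∘-resp-≈ˡ project₁))
                         (≈.trans (≈.sym assoc) (∘-resp-≈ˡ project₂)))

  ⁂-resp-≈ˡ : ∀ {A B C D} {f g : A ⇒ B} {h : C ⇒ D} → f ≈ g → f ⁂ h ≈ g ⁂ h
  ⁂-resp-≈ˡ p = ⟨⟩-resp-≈ (∘-resp-≈ˡ p) ≈.refl

  curry-resp-≈ : ∀ {X A B} {f g : X × A ⇒ B} → f ≈ g → curry f ≈ curry g
  curry-resp-≈ p = curry-unique (≈.trans β p)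

  curry∘ : ∀ {Y X A B} (f : X × A ⇒ B) (h : Y ⇒ X) →
           curry f ∘ h ≈ curry (f ∘ (h ⁂ id))
  curry∘ f h = curry-unique (begin
    eval ∘ ⟨ (curry f ∘ h) ∘ π₁ , π₂ ⟩
      ≈⟨ ∘-resp-≈ʳ (⟨⟩-resp-≈ (≈.trans assoc (∘-resp-≈ʳ (≈.sym project₁))) (≈.sym identityˡ)) ⟩
    eval ∘ ⟨ curry f ∘ (π₁ ∘ (h ⁂ id)) , id ∘ π₂ ⟩
      ≈⟨ ∘-resp-≈ʳ (⟨⟩-resp-≈ (≈.sym assoc) (≈.sym project₂)) ⟩
    eval ∘ ⟨ (curry f ∘ π₁) ∘ (h ⁂ id) , π₂ ∘ (h ⁂ id) ⟩
      ≈⟨ ∘-resp-≈ʳ (≈.sym ⟨⟩∘) ⟩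
    eval ∘ (⟨ curry f ∘ π₁ , π₂ ⟩ ∘ (h ⁂ id))
      ≈⟨ ≈.sym assoc ⟩
    (eval ∘ ⟨ curry f ∘ π₁ , π₂ ⟩) ∘ (h ⁂ id)
      ≈⟨ ∘-resp-≈ˡ β ⟩
    f ∘ (h ⁂ id)
      ∎)

  η-natural : ∀ {X Y} (f : X ⇒ Y) → ◇₁ f ∘ η X ≈ η Y ∘ f
  η-natural {X} {Y} f = begin
    ◇₁ f ∘ (ε (◇ X) ∘ ηᵐ X)         ≈⟨ ≈.sym assoc ⟩
    (◇₁ f ∘ ε (◇ X)) ∘ ηᵐ X         ≈⟨ ∘-resp-≈ˡ (≈.sym (ε-natural (◇₁ f))) ⟩
    (ε (◇ Y) ∘ □₁ (◇₁ f)) ∘ ηᵐ X    ≈⟨ assoc ⟩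
    ε (◇ Y) ∘ (□₁ (◇₁ f) ∘ ηᵐ X)    ≈⟨ ∘-resp-≈ʳ (≈.sym (ηᵐ-natural f)) ⟩
    ε (◇ Y) ∘ (ηᵐ Y ∘ f)            ≈⟨ ≈.sym assoc ⟩
    (ε (◇ Y) ∘ ηᵐ Y) ∘ f            ∎

  -- μ is inverse to η_◇, so its naturality follows from that of η.
  μ-natural : ∀ {X Y} (f : X ⇒ Y) → ◇₁ f ∘ μ X ≈ μ Y ∘ ◇₁ (◇₁ f)
  μ-natural {X} {Y} f = begin
    ◇₁ f ∘ μ X                           ≈⟨ ≈.sym identityˡ ⟩
    id ∘ (◇₁ f ∘ μ X)                    ≈⟨ ∘-resp-≈ˡ (≈.sym idem-μη) ⟩
    (μ Y ∘ η (◇ Y)) ∘ (◇₁ f ∘ μ X)       ≈⟨ assoc ⟩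
    μ Y ∘ (η (◇ Y) ∘ (◇₁ f ∘ μ X))       ≈⟨ ∘-resp-≈ʳ (≈.sym assoc) ⟩
    μ Y ∘ ((η (◇ Y) ∘ ◇₁ f) ∘ μ X)       ≈⟨ ∘-resp-≈ʳ (∘-resp-≈ˡ (≈.sym (η-natural (◇₁ f)))) ⟩
    μ Y ∘ ((◇₁ (◇₁ f) ∘ η (◇ X)) ∘ μ X)  ≈⟨ ∘-resp-≈ʳ assoc ⟩
    μ Y ∘ (◇₁ (◇₁ f) ∘ (η (◇ X) ∘ μ X))  ≈⟨ ∘-resp-≈ʳ (∘-resp-≈ʳ idem-ημ) ⟩
    μ Y ∘ (◇₁ (◇₁ f) ∘ id)               ≈⟨ ∘-resp-≈ʳ identityʳ ⟩
    μ Y ∘ ◇₁ (◇₁ f)                      ∎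

  factor-! : ∀ {X Y} (w : X ⇒ Y) → ! ≈ ! ∘ w
  factor-! w = !-unique (! ∘ w)

  factor-⟨⟩ : ∀ {X Y A B} {a : X ⇒ A} {a′ : Y ⇒ A} {b : X ⇒ B} {b′ : Y ⇒ B} {w : X ⇒ Y} →
              a ≈ a′ ∘ w → b ≈ b′ ∘ w → ⟨ a , b ⟩ ≈ ⟨ a′ , b′ ⟩ ∘ w
  factor-⟨⟩ p q = ≈.trans (⟨⟩-resp-≈ p q) (≈.sym ⟨⟩∘)

  factor-∘ : ∀ {X Y A B} (g : A ⇒ B) {a : X ⇒ A} {a′ : Y ⇒ A} {w : X ⇒ Y} →
             a ≈ a′ ∘ w → g ∘ a ≈ (g ∘ a′) ∘ w
  factor-∘ g p = ≈.trans (∘-resp-≈ʳ p) (≈.sym assoc)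

  factor-curry : ∀ {X Y A B} {a : X × A ⇒ B} {a′ : Y × A ⇒ B} {w : X ⇒ Y} →
                 a ≈ a′ ∘ (w ⁂ id) → curry a ≈ curry a′ ∘ w
  factor-curry {a′ = a′} {w} p = ≈.trans (curry-resp-≈ p) (≈.sym (curry∘ a′ w))

  factor-shut : ∀ {X Y A} {a : ◇ X ⇒ A} {a′ : ◇ Y ⇒ A} {w : X ⇒ Y} →
                a ≈ a′ ∘ ◇₁ w → □₁ a ∘ ηᵐ X ≈ (□₁ a′ ∘ ηᵐ Y) ∘ w
  factor-shut {X} {Y} {a = a} {a′} {w} p = begin
    □₁ a ∘ ηᵐ X                   ≈⟨ ∘-resp-≈ˡ (≈.trans (□F.F-resp-≈ p) □F.homomorphism) ⟩
    (□₁ a′ ∘ □₁ (◇₁ w)) ∘ ηᵐ X    ≈⟨ assoc ⟩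
    □₁ a′ ∘ (□₁ (◇₁ w) ∘ ηᵐ X)    ≈⟨ ∘-resp-≈ʳ (≈.sym (ηᵐ-natural w)) ⟩
    □₁ a′ ∘ (ηᵐ Y ∘ w)            ≈⟨ ≈.sym assoc ⟩
    (□₁ a′ ∘ ηᵐ Y) ∘ w            ∎

  factor-open : ∀ {X Y P Q C} {a : P ⇒ □ C} {a′ : Q ⇒ □ C} {v : P ⇒ Q}
                {L : X ⇒ ◇ P} {L′ : Y ⇒ ◇ Q} {w : X ⇒ Y} →
                a ≈ a′ ∘ v → ◇₁ v ∘ L ≈ L′ ∘ w →
                (εᵐ C ∘ ◇₁ a) ∘ L ≈ ((εᵐ C ∘ ◇₁ a′) ∘ L′) ∘ w
  factor-open {C = C} {a = a} {a′} {v} {L} {L′} {w} p square = begin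
    (εᵐ C ∘ ◇₁ a) ∘ L             ≈⟨ ∘-resp-≈ˡ (∘-resp-≈ʳ (≈.trans (◇F.F-resp-≈ p) ◇F.homomorphism)) ⟩
    (εᵐ C ∘ (◇₁ a′ ∘ ◇₁ v)) ∘ L   ≈⟨ ∘-resp-≈ˡ (≈.sym assoc) ⟩
    ((εᵐ C ∘ ◇₁ a′) ∘ ◇₁ v) ∘ L   ≈⟨ assoc ⟩
    (εᵐ C ∘ ◇₁ a′) ∘ (◇₁ v ∘ L)   ≈⟨ ∘-resp-≈ʳ square ⟩
    (εᵐ C ∘ ◇₁ a′) ∘ (L′ ∘ w)     ≈⟨ ≈.sym assoc ⟩
    ((εᵐ C ∘ ◇₁ a′) ∘ L′) ∘ w     ∎

  factor-∘π₁ : ∀ {X Y Z C} {P : X ⇒ Z} {Q : Y ⇒ Z} {w : X ⇒ Y} →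
               P ≈ Q ∘ w → P ∘ π₁ ≈ (Q ∘ π₁) ∘ (w ⁂ id {C})
  factor-∘π₁ p =
    ≈.trans (∘-resp-≈ˡ p) (≈.trans assoc (≈.trans (∘-resp-≈ʳ (≈.sym project₁)) (≈.sym assoc)))

  square-∘π₁ : ∀ {X Y Z W C} {v : Z ⇒ W} {P : X ⇒ Z} {Q : Y ⇒ W} {w : X ⇒ Y} →
               v ∘ P ≈ Q ∘ w → v ∘ (P ∘ π₁) ≈ (Q ∘ π₁) ∘ (w ⁂ id {C})
  square-∘π₁ p = ≈.trans (≈.sym assoc) (factor-∘π₁ p)

  factor-μ∘◇₁ : ∀ {X Y Z} {P : X ⇒ ◇ Z} {Q : Y ⇒ ◇ Z} {w : X ⇒ Y} →
                P ≈ Q ∘ w → μ Z ∘ ◇₁ P ≈ (μ Z ∘ ◇₁ Q) ∘ ◇₁ w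
  factor-μ∘◇₁ p = ≈.trans (∘-resp-≈ʳ (≈.trans (◇F.F-resp-≈ p) ◇F.homomorphism)) (≈.sym assoc)

  square-μ∘◇₁ : ∀ {X Y Z Z′} {v : Z ⇒ Z′} {P : X ⇒ ◇ Z} {Q : Y ⇒ ◇ Z′} {w : X ⇒ Y} →
                ◇₁ v ∘ P ≈ Q ∘ w → ◇₁ v ∘ (μ Z ∘ ◇₁ P) ≈ (μ Z′ ∘ ◇₁ Q) ∘ ◇₁ w
  square-μ∘◇₁ {Z = Z} {Z′} {v} {P} {Q} {w} p = begin
    ◇₁ v ∘ (μ Z ∘ ◇₁ P)            ≈⟨ ≈.sym assoc ⟩
    (◇₁ v ∘ μ Z) ∘ ◇₁ P            ≈⟨ ∘-resp-≈ˡ (μ-natural v) ⟩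
    (μ Z′ ∘ ◇₁ (◇₁ v)) ∘ ◇₁ P      ≈⟨ assoc ⟩
    μ Z′ ∘ (◇₁ (◇₁ v) ∘ ◇₁ P)      ≈⟨ ∘-resp-≈ʳ (≈.sym ◇F.homomorphism) ⟩
    μ Z′ ∘ ◇₁ (◇₁ v ∘ P)           ≈⟨ factor-μ∘◇₁ p ⟩
    (μ Z′ ∘ ◇₁ Q) ∘ ◇₁ w           ∎

  -- The lock replacement l_{Γ′} at ⟦ Γ ⟧, read directly on ⟦ Γ ⧺ Γ′ ⟧ so that no
  -- transport along ⧺-sem is needed.
  l⧺ : ∀ Γ Γ′ → ⟦ Γ ⧺ Γ′ ⟧ctx ⇒ ◇ ⟦ Γ ⟧ctx
  l⧺ Γ ·            = η _
  l⧺ Γ (Γ′ , x ∶ A) = l⧺ Γ Γ′ ∘ π₁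
  l⧺ Γ (Γ′ ,•)      = μ _ ∘ ◇₁ (l⧺ Γ Γ′)

  π₁∘≡⇒ : ∀ {X Y C} (p : X ≡ Y) → π₁ {B = C} ∘ ≡⇒ (cong (_× C) p) ≈ ≡⇒ p ∘ π₁
  π₁∘≡⇒ refl = ≈.trans identityʳ (≈.sym identityˡ)

  ◇₁∘≡⇒ : ∀ {X Y Z} (p : X ≡ Y) (h : Y ⇒ Z) → ◇₁ h ∘ ≡⇒ (cong ◇ p) ≈ ◇₁ (h ∘ ≡⇒ p)
  ◇₁∘≡⇒ refl h = ≈.trans identityʳ (◇F.F-resp-≈ (≈.sym identityʳ))

  l∘≡⇒≈l⧺ : ∀ Γ Γ′ → l Γ′ ⟦ Γ ⟧ctx ∘ ≡⇒ (⧺-sem Γ Γ′) ≈ l⧺ Γ Γ′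
  l∘≡⇒≈l⧺ Γ · = identityʳ
  l∘≡⇒≈l⧺ Γ (Γ′ , x ∶ A) =
    ≈.trans assoc (≈.trans (∘-resp-≈ʳ (π₁∘≡⇒ (⧺-sem Γ Γ′)))
                           (≈.trans (≈.sym assoc) (∘-resp-≈ˡ (l∘≡⇒≈l⧺ Γ Γ′))))
  l∘≡⇒≈l⧺ Γ (Γ′ ,•) =
    ≈.trans assoc (∘-resp-≈ʳ (≈.trans (◇₁∘≡⇒ (⧺-sem Γ Γ′) _) (◇F.F-resp-≈ (l∘≡⇒≈l⧺ Γ Γ′))))

  ⟦open′⟧≈ : ∀ {Γ t A} Γ′ (D : Γ ⊢ t ∶ □ᵗ A) →
             ⟦ open′ Γ′ D ⟧ ≈ (εᵐ ⟦ A ⟧ty ∘ ◇₁ ⟦ D ⟧) ∘ l⧺ Γ Γ′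
  ⟦open′⟧≈ {Γ} Γ′ D = ≈.trans (∘-resp-≈ʳ (∘-resp-≈ʳ (l∘≡⇒≈l⧺ Γ Γ′))) (≈.sym assoc)

  factor-⟦open′⟧ : ∀ {Γ₁ Γ₂ t₁ t₂ A} Γ′ (D₁ : Γ₁ ⊢ t₁ ∶ □ᵗ A) (D₂ : Γ₂ ⊢ t₂ ∶ □ᵗ A)
                   {v : ⟦ Γ₁ ⟧ctx ⇒ ⟦ Γ₂ ⟧ctx} {w : ⟦ Γ₁ ⧺ Γ′ ⟧ctx ⇒ ⟦ Γ₂ ⧺ Γ′ ⟧ctx} →
                   ⟦ D₁ ⟧ ≈ ⟦ D₂ ⟧ ∘ v → ◇₁ v ∘ l⧺ Γ₁ Γ′ ≈ l⧺ Γ₂ Γ′ ∘ w →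
                   ⟦ open′ Γ′ D₁ ⟧ ≈ ⟦ open′ Γ′ D₂ ⟧ ∘ w
  factor-⟦open′⟧ Γ′ D₁ D₂ p square =
    ≈.trans (⟦open′⟧≈ Γ′ D₁)
            (≈.trans (factor-open p square) (∘-resp-≈ˡ (≈.sym (⟦open′⟧≈ Γ′ D₂))))

  factor-⟦open′⟧-l⧺ : ∀ {Γ t A} Γ₁′ Γ₂′ (D : Γ ⊢ t ∶ □ᵗ A)
                      {w : ⟦ Γ ⧺ Γ₁′ ⟧ctx ⇒ ⟦ Γ ⧺ Γ₂′ ⟧ctx} →
                      l⧺ Γ Γ₁′ ≈ l⧺ Γ Γ₂′ ∘ w →
                      ⟦ open′ Γ₁′ D ⟧ ≈ ⟦ open′ Γ₂′ D ⟧ ∘ w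
  factor-⟦open′⟧-l⧺ Γ₁′ Γ₂′ D square =
    ≈.trans (⟦open′⟧≈ Γ₁′ D)
            (≈.trans (factor-∘ _ square) (∘-resp-≈ˡ (≈.sym (⟦open′⟧≈ Γ₂′ D))))

  π-del : ∀ {x A Δ Δ⁻} → Del (evar x A) Δ Δ⁻ → ⟦ Δ ⟧ctx ⇒ ⟦ Δ⁻ ⟧ctx
  π-del del-var       = π₁
  π-del (keep-var d)  = π-del d ⁂ id
  π-del (keep-lock d) = ◇₁ (π-del d)

  η-del : ∀ {Δ Δ⁻} → Del elock Δ Δ⁻ → ⟦ Δ⁻ ⟧ctx ⇒ ⟦ Δ ⟧ctx
  η-del del-lock      = η _
  η-del (keep-var d)  = η-del d ⁂ id
  η-del (keep-lock d) = ◇₁ (η-del d)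

  ≡⇒-conj-⁂ : ∀ {X Y Z W C} (p : X ≡ Y) (q : Z ≡ W) (h : W ⇒ Y) →
              ≡⇒ (sym (cong (_× C) p)) ∘ ((h ⁂ id) ∘ ≡⇒ (cong (_× C) q))
                ≈ (≡⇒ (sym p) ∘ (h ∘ ≡⇒ q)) ⁂ id
  ≡⇒-conj-⁂ refl refl h =
    ≈.trans identityˡ (≈.trans identityʳ (⁂-resp-≈ˡ (≈.sym (≈.trans identityˡ identityʳ))))

  ≡⇒-conj-◇ : ∀ {X Y Z W} (p : X ≡ Y) (q : Z ≡ W) (h : W ⇒ Y) →
              ≡⇒ (sym (cong ◇ p)) ∘ (◇₁ h ∘ ≡⇒ (cong ◇ q)) ≈ ◇₁ (≡⇒ (sym p) ∘ (h ∘ ≡⇒ q))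
  ≡⇒-conj-◇ refl refl h =
    ≈.trans identityˡ (≈.trans identityʳ (◇F.F-resp-≈ (≈.sym (≈.trans identityˡ identityʳ))))

  π-del-delVarAt : ∀ Γ x A Γ′ → π-del (delVarAt Γ x A Γ′)
                     ≈ ≡⇒ (sym (⧺-sem Γ Γ′)) ∘ (⟦ Γ′ ⟧F₁ π₁ ∘ ≡⇒ (⧺-sem (Γ , x ∶ A) Γ′))
  π-del-delVarAt Γ x A · = ≈.sym (≈.trans identityˡ identityʳ)
  π-del-delVarAt Γ x A (Γ′ , y ∶ B) =
    ≈.trans (⁂-resp-≈ˡ (π-del-delVarAt Γ x A Γ′))
            (≈.sym (≡⇒-conj-⁂ (⧺-sem Γ Γ′) (⧺-sem (Γ , x ∶ A) Γ′) _))
  π-del-delVarAt Γ x A (Γ′ ,•) =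
    ≈.trans (◇F.F-resp-≈ (π-del-delVarAt Γ x A Γ′))
            (≈.sym (≡⇒-conj-◇ (⧺-sem Γ Γ′) (⧺-sem (Γ , x ∶ A) Γ′) _))

  η-del-delLockAt : ∀ Γ Γ′ → η-del (delLockAt Γ Γ′)
                      ≈ ≡⇒ (sym (⧺-sem (Γ ,•) Γ′)) ∘ (⟦ Γ′ ⟧F₁ (η ⟦ Γ ⟧ctx) ∘ ≡⇒ (⧺-sem Γ Γ′))
  η-del-delLockAt Γ · = ≈.sym (≈.trans identityˡ identityʳ)
  η-del-delLockAt Γ (Γ′ , y ∶ B) =
    ≈.trans (⁂-resp-≈ˡ (η-del-delLockAt Γ Γ′))
            (≈.sym (≡⇒-conj-⁂ (⧺-sem (Γ ,•) Γ′) (⧺-sem Γ Γ′) _))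
  η-del-delLockAt Γ (Γ′ ,•) =
    ≈.trans (◇F.F-resp-≈ (η-del-delLockAt Γ Γ′))
            (≈.sym (≡⇒-conj-◇ (⧺-sem (Γ ,•) Γ′) (⧺-sem Γ Γ′) _))

  π-del-Square : ∀ {x A} Γ Γ′ {Δ⁻} → Del (evar x A) (Γ ⧺ Γ′) Δ⁻ →
                 SplitDel (evar x A) Γ Γ′ Δ⁻ → Set e
  π-del-Square Γ Γ′ d (left  {Γ⁻}  d′) = ◇₁ (π-del d′) ∘ l⧺ Γ Γ′ ≈ l⧺ Γ⁻ Γ′ ∘ π-del d
  π-del-Square Γ Γ′ d (right {Γ′⁻} d′) = l⧺ Γ Γ′ ≈ l⧺ Γ Γ′⁻ ∘ π-del d

  l⧺-π-del : ∀ {x A} Γ Γ′ {Δ⁻} (d : Del (evar x A) (Γ ⧺ Γ′) Δ⁻) →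
             π-del-Square Γ Γ′ d (splitDel Γ Γ′ d)
  l⧺-π-del Γ · d = η-natural (π-del d)
  l⧺-π-del Γ (Γ′ , y ∶ B) del-var = ≈.refl
  l⧺-π-del Γ (Γ′ , y ∶ B) (keep-var d) with splitDel Γ Γ′ d | l⧺-π-del Γ Γ′ d
  ... | left  _ | square = square-∘π₁ square
  ... | right _ | square = factor-∘π₁ square
  l⧺-π-del Γ (Γ′ ,•) (keep-lock d) with splitDel Γ Γ′ d | l⧺-π-del Γ Γ′ d
  ... | left  _ | square = square-μ∘◇₁ square
  ... | right _ | square = factor-μ∘◇₁ square

  η-del-Square : ∀ Γ Γ′ {Δ⁻} → Del elock (Γ ⧺ Γ′) Δ⁻ → SplitDel elock Γ Γ′ Δ⁻ → Set e
  η-del-Square Γ Γ′ d (left  {Γ⁻}  d′) = ◇₁ (η-del d′) ∘ l⧺ Γ⁻ Γ′ ≈ l⧺ Γ Γ′ ∘ η-del d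
  η-del-Square Γ Γ′ d (right {Γ′⁻} d′) = l⧺ Γ Γ′⁻ ≈ l⧺ Γ Γ′ ∘ η-del d

  l⧺-η-del : ∀ Γ Γ′ {Δ⁻} (d : Del elock (Γ ⧺ Γ′) Δ⁻) →
             η-del-Square Γ Γ′ d (splitDel Γ Γ′ d)
  l⧺-η-del Γ · d = η-natural (η-del d)
  l⧺-η-del Γ (Γ′ , y ∶ B) (keep-var d) with splitDel Γ Γ′ d | l⧺-η-del Γ Γ′ d
  ... | left  _ | square = square-∘π₁ square
  ... | right _ | square = factor-∘π₁ square
  l⧺-η-del Γ (Γ′ ,•) del-lock = ≈.sym (begin
    (μ _ ∘ ◇₁ (l⧺ Γ Γ′)) ∘ η _     ≈⟨ assoc ⟩
    μ _ ∘ (◇₁ (l⧺ Γ Γ′) ∘ η _)     ≈⟨ ∘-resp-≈ʳ (η-natural _) ⟩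
    μ _ ∘ (η _ ∘ l⧺ Γ Γ′)          ≈⟨ ≈.sym assoc ⟩
    (μ _ ∘ η _) ∘ l⧺ Γ Γ′          ≈⟨ ∘-resp-≈ˡ idem-μη ⟩
    id ∘ l⧺ Γ Γ′                   ≈⟨ identityˡ ⟩
    l⧺ Γ Γ′                        ∎)
  l⧺-η-del Γ (Γ′ ,•) (keep-lock d) with splitDel Γ Γ′ d | l⧺-η-del Γ Γ′ d
  ... | left  _ | square = square-μ∘◇₁ square
  ... | right _ | square = factor-μ∘◇₁ square

  NF-⊆ : ∀ {e t u} → (∀ {x} → x ∈FV t → x ∈FV u) → NF e u → NF e t
  NF-⊆ t⊆u nf p f = nf p (t⊆u f)

  ⟦∋⟧-strengthen-var : ∀ {x A Δ Δ⁻ y B} (d : Del (evar x A) Δ Δ⁻) (m : Δ ∋ y ∶ B)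
                       (nf : NF (evar x A) (var y)) →
                       ⟦ m ⟧∋ ≈ ⟦ strengthen-∋ d m nf ⟧∋ ∘ π-del d
  ⟦∋⟧-strengthen-var del-var      here      nf = ⊥-elim (nf refl fv-var)
  ⟦∋⟧-strengthen-var del-var      (there m) nf = ≈.refl
  ⟦∋⟧-strengthen-var (keep-var d) here      nf = ≈.sym (≈.trans project₂ identityˡ)
  ⟦∋⟧-strengthen-var (keep-var d) (there m) nf = factor-∘π₁ (⟦∋⟧-strengthen-var d m nf)

  ⟦⟧-strengthen-var : ∀ {x A Δ Δ⁻ t B} (d : Del (evar x A) Δ Δ⁻) (D : Δ ⊢ t ∶ B)
                      (nf : NF (evar x A) t) →
                      ⟦ D ⟧ ≈ ⟦ strengthen d D nf ⟧ ∘ π-del d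
  ⟦⟧-strengthen-var d (var m) nf = ⟦∋⟧-strengthen-var d m nf
  ⟦⟧-strengthen-var d tt nf = factor-! (π-del d)
  ⟦⟧-strengthen-var d (pair D₁ D₂) nf =
    factor-⟨⟩ (⟦⟧-strengthen-var d D₁ (NF-⊆ fv-pairₗ nf))
              (⟦⟧-strengthen-var d D₂ (NF-⊆ fv-pairᵣ nf))
  ⟦⟧-strengthen-var d (fst D) nf = factor-∘ π₁ (⟦⟧-strengthen-var d D (NF-⊆ fv-fst nf))
  ⟦⟧-strengthen-var d (snd D) nf = factor-∘ π₂ (⟦⟧-strengthen-var d D (NF-⊆ fv-snd nf))
  ⟦⟧-strengthen-var d (lam fr D) nf =
    factor-curry (⟦⟧-strengthen-var (keep-var d) D (nf-lam d fr nf))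
  ⟦⟧-strengthen-var d (app D₁ D₂) nf =
    factor-∘ eval (factor-⟨⟩ (⟦⟧-strengthen-var d D₁ (NF-⊆ fv-appₗ nf))
                             (⟦⟧-strengthen-var d D₂ (NF-⊆ fv-appᵣ nf)))
  ⟦⟧-strengthen-var d (shut D) nf =
    factor-shut (⟦⟧-strengthen-var (keep-lock d) D (NF-⊆ fv-shut nf))
  ⟦⟧-strengthen-var d (open′ {Γ = Γ} Γ′ D) nf
    with splitDel Γ Γ′ d | l⧺-π-del Γ Γ′ d
  ... | left d′ | square =
    factor-⟦open′⟧ Γ′ D (strengthen d′ D nf′) (⟦⟧-strengthen-var d′ D nf′) square
    where nf′ = NF-⊆ fv-open nf
  ... | right {Γ′⁻} d′ | square = factor-⟦open′⟧-l⧺ Γ′ Γ′⁻ D square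

  ⟦∋⟧-strengthen-lock : ∀ {Δ Δ⁻ y B} (d : Del elock Δ Δ⁻) (m : Δ ∋ y ∶ B)
                        (nf : NF elock (var y)) →
                        ⟦ strengthen-∋ d m nf ⟧∋ ≈ ⟦ m ⟧∋ ∘ η-del d
  ⟦∋⟧-strengthen-lock (keep-var d) here      nf = ≈.sym (≈.trans project₂ identityˡ)
  ⟦∋⟧-strengthen-lock (keep-var d) (there m) nf = factor-∘π₁ (⟦∋⟧-strengthen-lock d m nf)

  ⟦⟧-strengthen-lock : ∀ {Δ Δ⁻ t B} (d : Del elock Δ Δ⁻) (D : Δ ⊢ t ∶ B) (nf : NF elock t) →
                       ⟦ strengthen d D nf ⟧ ≈ ⟦ D ⟧ ∘ η-del d
  ⟦⟧-strengthen-lock d (var m) nf = ⟦∋⟧-strengthen-lock d m nf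
  ⟦⟧-strengthen-lock d tt nf = factor-! (η-del d)
  ⟦⟧-strengthen-lock d (pair D₁ D₂) nf =
    factor-⟨⟩ (⟦⟧-strengthen-lock d D₁ (NF-⊆ fv-pairₗ nf))
              (⟦⟧-strengthen-lock d D₂ (NF-⊆ fv-pairᵣ nf))
  ⟦⟧-strengthen-lock d (fst D) nf = factor-∘ π₁ (⟦⟧-strengthen-lock d D (NF-⊆ fv-fst nf))
  ⟦⟧-strengthen-lock d (snd D) nf = factor-∘ π₂ (⟦⟧-strengthen-lock d D (NF-⊆ fv-snd nf))
  ⟦⟧-strengthen-lock d (lam fr D) nf =
    factor-curry (⟦⟧-strengthen-lock (keep-var d) D (nf-lam d fr nf))
  ⟦⟧-strengthen-lock d (app D₁ D₂) nf =
    factor-∘ eval (factor-⟨⟩ (⟦⟧-strengthen-lock d D₁ (NF-⊆ fv-appₗ nf))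
                             (⟦⟧-strengthen-lock d D₂ (NF-⊆ fv-appᵣ nf)))
  ⟦⟧-strengthen-lock d (shut D) nf =
    factor-shut (⟦⟧-strengthen-lock (keep-lock d) D (NF-⊆ fv-shut nf))
  ⟦⟧-strengthen-lock d (open′ {Γ = Γ} Γ′ D) nf
    with splitDel Γ Γ′ d | l⧺-η-del Γ Γ′ d
  ... | left d′ | square =
    factor-⟦open′⟧ Γ′ (strengthen d′ D nf′) D (⟦⟧-strengthen-lock d′ D nf′) square
    where nf′ = NF-⊆ fv-open nf
  ... | right {Γ′⁻} d′ | square = factor-⟦open′⟧-l⧺ Γ′⁻ Γ′ D square

lemma7 : ∀ {o ℓ e} (M : Model o ℓ e) (atom : ℕ → Model.Obj M) →
    let open Model M
        open Semantics M atom
    in (∀ Γ x A Γ′ {t B} (D : (Γ , x ∶ A) ⧺ Γ′ ⊢ t ∶ B) (nf : ¬ (x ∈FV t)) →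
          ⟦ D ⟧ ≈ (⟦ strengthenVar Γ x A Γ′ D nf ⟧ ∘ ≡⇒ (sym (⧺-sem Γ Γ′)))
                  ∘ (⟦ Γ′ ⟧F₁ π₁ ∘ ≡⇒ (⧺-sem (Γ , x ∶ A) Γ′)))
       ∧ (∀ Γ Γ′ {t B} (D : (Γ ,•) ⧺ Γ′ ⊢ t ∶ B) →
          ⟦ strengthenLock Γ Γ′ D ⟧ ≈ (⟦ D ⟧ ∘ ≡⇒ (sym (⧺-sem (Γ ,•) Γ′)))
                  ∘ (⟦ Γ′ ⟧F₁ (η ⟦ Γ ⟧ctx) ∘ ≡⇒ (⧺-sem Γ Γ′)))
lemma7 M atom =
  (λ Γ x A Γ′ D nf →
     ≈.trans (⟦⟧-strengthen-var (delVarAt Γ x A Γ′) D _)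
             (≈.trans (∘-resp-≈ʳ (π-del-delVarAt Γ x A Γ′)) (≈.sym assoc)))
  & (λ Γ Γ′ D →
     ≈.trans (⟦⟧-strengthen-lock (delLockAt Γ Γ′) D _)
             (≈.trans (∘-resp-≈ʳ (η-del-delLockAt Γ Γ′)) (≈.sym assoc)))
  where
  open Model M using (assoc)
  open Soundness M atom
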